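{- Let $v\in S_n$, let $I$ be any hypercube decomposition of $[e,v]$, and let $Y\in\mathcal{A}_e$. Let $\eta=y_1y_2\cdots y_{|Y|}$ be the product of the elements of $Y$ taken in some order. Then there is a hypercube subgraph of the Bruhat graph $\Gamma$ of $S_n$ with bottom vertex $e$, spanned by $Y$, and with top vertex $\eta$ (here $\eta$ need not lie in $[e,v]$).
   Context: $S_n$: symmetric group, $e$ identity, length $\ell$. Bruhat graph $\Gamma$: vertices $S_n$, edge $x\to y$ when $yx^{ -1}$ is a transposition and $\ell(x)<\ell(y)$; Bruhat order $x\le y$ iff a directed path exists; $\Gamma(e,v)$ induced subgraph on $[e,v]$. A hypercube is a subgraph isomorphic to the upward directed Hasse diagram of a Boolean lattice of subsets of a finite set; it is spanned by the set of endpoints of the edges leaving its bottom vertex; diamond = $2$-hypercube; $I$ diamond-closed if it contains the fourth vertex of each diamond of $\Gamma(e,v)$ of which it contains three. For $x\in I$: $\mathcal{Y}_x=\{y\in[e,v]\setminus I: x\to y\}$ and $\mathcal{A}_x$ = antichains of $(\mathcal{Y}_x,\le)$. Hypercube cluster at $x$: for each $Y\in\mathcal{A}_x$ a unique hypercube in $\Gamma(e,v)$ with bottom $x$ spanned by $Y$. Hypercube decomposition of $[e,v]$: $I=[e,z]$ for some $z\in[e,v]$, diamond-closed, with a hypercube cluster at every $x\in I$. Elements of $\mathcal{Y}_e$ are transpositions. -}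

module Defs where

open import Data.Nat as ℕ using (ℕ; zero; suc)
open import Data.Bool using (Bool; true; false; if_then_else_; _∧_)
open import Data.Fin as Fin using (Fin)
open import Data.Fin.Subset as Sub using (Subset; ⁅_⁆; _∪_; _∉_)
open import Data.Fin.Permutation.Components using (transpose)
open import Data.Vec using (Vec; lookup; tabulate; map; foldr; allFin)
open import Data.List as List using (List)
open import Data.Nat.ListAction using (sum)
open import Data.Product using (Σ; ∃; ∃₂; _×_; _,_)
open import Relation.Nullary using (¬_; Dec)
open import Relation.Nullary.Decidable using (⌊_⌋)
open import Relation.Binary.PropositionalEquality using (_≡_; _≢_)
open import Relation.Binary.Construct.Closure.ReflexiveTransitive using (Star)
open import Function.Definitions using (Injective)

-- Elements of S_n in one-line notation: w(i) = lookup w i.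
Perm : ℕ → Set
Perm n = Vec (Fin n) n

IsPerm : ∀ {n} → Perm n → Set
IsPerm {n} w = ∀ (i j : Fin n) → lookup w i ≡ lookup w j → i ≡ j

e : ∀ {n} → Perm n
e {n} = allFin n

_·_ : ∀ {n} → Perm n → Perm n → Perm n
x · y = map (lookup x) y

transp : ∀ {n} → Fin n → Fin n → Perm n
transp a b = tabulate (transpose a b)

IsTransposition : ∀ {n} → Perm n → Set
IsTransposition w = ∃₂ λ a b → a ≢ b × w ≡ transp a b

ℓ : ∀ {n} → Perm n → ℕ
ℓ {n} x = sum (List.map (λ i → sum (List.map (λ j →
  if ⌊ i Fin.<? j ⌋ ∧ ⌊ lookup x j Fin.<? lookup x i ⌋ then 1 else 0)
  (List.allFin n))) (List.allFin n))

_⟶_ : ∀ {n} → Perm n → Perm n → Set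
x ⟶ y = Σ _ λ t → IsTransposition t × y ≡ t · x × ℓ x ℕ.< ℓ y

_≤B_ : ∀ {n} → Perm n → Perm n → Set
x ≤B y = Star _⟶_ x y

InInt : ∀ {n} → Perm n → Perm n → Set
InInt v x = e ≤B x × x ≤B v

-- h is a k-dimensional hypercube in the subgraph of Γ induced on the vertices
-- satisfying P: an injective labelling of the Boolean lattice of subsets of Fin k
-- whose upward Hasse-diagram edges S → S ∪ {i} are Bruhat-graph edges.
IsHypercube : ∀ {n} → (Perm n → Set) → (k : ℕ) → (Subset k → Perm n) → Set
IsHypercube P k h =
  (∀ S → P (h S)) ×
  Injective _≡_ _≡_ h ×
  (∀ S i → i ∉ S → h S ⟶ h (S ∪ ⁅ i ⁆))

BottomSpanned : ∀ {n k} → (Subset k → Perm n) → Perm n → Vec (Perm n) k → Set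
BottomSpanned h x Y = h Sub.⊥ ≡ x × (∀ i → h ⁅ i ⁆ ≡ lookup Y i)

In𝒴 : ∀ {n} → Perm n → (Perm n → Set) → Perm n → Perm n → Set
In𝒴 v I x y = InInt v y × ¬ I y × x ⟶ y

-- Y (listed without repetition) is an antichain of (𝒴_x, ≤)
InA : ∀ {n k} → Perm n → (Perm n → Set) → Perm n → Vec (Perm n) k → Set
InA v I x Y = (∀ i → In𝒴 v I x (lookup Y i)) ×
              (∀ i j → i ≢ j → ¬ (lookup Y i ≤B lookup Y j))

DiamondClosed : ∀ {n} → Perm n → (Perm n → Set) → Set
DiamondClosed v I = ∀ h → IsHypercube (InInt v) 2 h →
  ∀ S → (∀ T → T ≢ S → I (h T)) → I (h S)

HypercubeCluster : ∀ {n} → Perm n → (Perm n → Set) → Perm n → Set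
HypercubeCluster v I x = ∀ k (Y : Vec _ k) → InA v I x Y →
  Σ _ λ h → (IsHypercube (InInt v) k h × BottomSpanned h x Y) ×
    (∀ h' → IsHypercube (InInt v) k h' → BottomSpanned h' x Y → ∀ S → h' S ≡ h S)

record HypercubeDecomposition {n} (v : Perm n) (I : Perm n → Set) : Set where
  field
    z : Perm n
    z∈ : InInt v z
    I⇒ : ∀ x → I x → InInt z x
    ⇒I : ∀ x → InInt z x → I x
    diamondClosed : DiamondClosed v I
    cluster : ∀ x → I x → HypercubeCluster v I x

prod : ∀ {n k} → Vec (Perm n) k → Perm n
prod = foldr _ _·_ e

-- Every y ∈ 𝒴_e is a transposition (a b) with a < b.  Since (a b) ≤ (a d) for b < d and (c b) ≤ (a b)
-- for a < c, the transpositions of an antichain pairwise share neither their smaller nor their larger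
-- point.  For such y₁, …, y_k the cube sends S to the product, in index order, of the y_i with i ∈ S.
-- Inserting one more y_i = (a b) between P and Q multiplies P · Q on the left by (P a  P b); the
-- sharing condition forces P a < P b and Q⁻¹ a < Q⁻¹ b, so an ascent is swapped and the length
-- grows: every cube edge is a Bruhat edge.  For injectivity, cancel the common prefix of S and S'.
-- The pairs after the first difference (a, b) are the arcs of disjoint increasing paths, whose vertex
-- sets are preserved by all their products, whereas (a b) moves a, the top of its path, to b, which
-- lies on a path with a higher top.

module Submission where

open import Defs
open import Data.Nat using (ℕ)
open import Data.Unit using (⊤)
open import Data.Vec using (Vec)
open import Data.Fin.Subset using (Subset)
open import Data.Product using (Σ; _×_)
open import Relation.Binary.PropositionalEquality using (_≡_)
import Data.Fin.Subset as Sub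

open import Data.Unit using (tt)
open import Data.Nat as ℕ using (zero; suc; _+_; _≤_; _<_; z≤n; s≤s)
import Data.Nat.Properties as ℕ
import Data.Nat.ListAction as ListAction
open import Data.Bool using (true; false; if_then_else_; _∧_)
open import Data.Empty using (⊥-elim)
open import Data.Sum using (_⊎_; inj₁; inj₂)
open import Data.Product using (_,_; proj₁; proj₂; ∃; ∃₂)
open import Data.Fin as Fin using (Fin; zero; suc; toℕ; _≟_)
import Data.Fin.Properties as Fin
open import Data.Fin.Permutation.Components using (transpose; transpose-inverse)
open import Data.Fin.Subset using (⁅_⁆; _∪_; _∉_)
open import Data.Fin.Subset.Properties using (∪-identityʳ)
open import Data.Vec using (lookup; tabulate; toList; []; _∷_; here; there)
import Data.Vec.Properties as Vecₚ
open import Data.List using (List; []; _∷_; _++_)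
import Data.List as List
import Data.List.Properties as List
open import Data.List.Relation.Unary.All using (All; []; _∷_)
import Data.List.Relation.Unary.All as All
import Data.List.Relation.Unary.All.Properties as All
open import Function using (_∘_; id)
open import Relation.Nullary using (¬_; Dec; yes; no; does)
open import Relation.Nullary.Decidable using (⌊_⌋)
open import Relation.Binary using (tri<; tri≈; tri>)
open import Relation.Binary.PropositionalEquality
  using (_≢_; _≗_; refl; sym; trans; cong; cong₂; subst; subst₂; module ≡-Reasoning)
open import Relation.Binary.Construct.Closure.ReflexiveTransitive using (ε; _◅_)
open import Algebra.Properties.CommutativeMonoid.Sum ℕ.+-0-commutativeMonoid
  using (sum; sum-syntax; sum-cong-≗; ∑-distrib-+)
open import Algebra.Properties.CommutativeSemigroup ℕ.+-commutativeSemigroup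
  using (x∙yz≈y∙xz)

sum-allFin : ∀ {n} (f : Fin n → ℕ) → ListAction.sum (List.map f (List.allFin n)) ≡ sum f
sum-allFin {n} f = trans (cong ListAction.sum (List.map-tabulate id f)) (sum-tabulate f)
  where
  sum-tabulate : ∀ {n} (g : Fin n → ℕ) → ListAction.sum (List.tabulate g) ≡ sum g
  sum-tabulate {zero} g = refl
  sum-tabulate {suc n} g = cong (g zero +_) (sum-tabulate (g ∘ suc))

sum-mono-≤ : ∀ {n} {f g : Fin n → ℕ} → (∀ x → f x ≤ g x) → sum f ≤ sum g
sum-mono-≤ {zero} f≤g = z≤n
sum-mono-≤ {suc n} f≤g = ℕ.+-mono-≤ (f≤g zero) (sum-mono-≤ (f≤g ∘ suc))

erase : ∀ {n} → Fin n → (Fin n → ℕ) → Fin n → ℕ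
erase i f x = if does (x ≟ i) then 0 else f x

erase-other : ∀ {n} (i : Fin n) f {x} → x ≢ i → erase i f x ≡ f x
erase-other i f {x} x≢i with x ≟ i
... | yes x≡i = ⊥-elim (x≢i x≡i)
... | no _ = refl

sum-erase : ∀ {n} (f : Fin n → ℕ) i → sum f ≡ f i + sum (erase i f)
sum-erase f zero = refl
sum-erase f (suc i) = begin
  f zero + sum (f ∘ suc)               ≡⟨ cong (f zero +_) (sum-erase (f ∘ suc) i) ⟩
  f zero + (f (suc i) + rest)          ≡⟨ x∙yz≈y∙xz (f zero) (f (suc i)) rest ⟩
  f (suc i) + (f zero + rest)          ∎
  where
  open ≡-Reasoning
  rest : ℕ
  rest = sum (erase i (f ∘ suc))

module _ {n} {f g : Fin n → ℕ} {i j : Fin n} (i≢j : i ≢ j)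
         (off : ∀ x → x ≢ i → x ≢ j → f x ≤ g x) where

  private
    rest : (Fin n → ℕ) → ℕ
    rest h = sum (erase j (erase i h))

    sum-split : ∀ h → sum h ≡ (h i + h j) + rest h
    sum-split h = begin
      sum h                                ≡⟨ sum-erase h i ⟩
      h i + sum (erase i h)                ≡⟨ cong (h i +_) (sum-erase (erase i h) j) ⟩
      h i + (erase i h j + rest h)         ≡⟨ cong (λ y → h i + (y + rest h)) (erase-other i h j≢i) ⟩
      h i + (h j + rest h)                 ≡⟨ ℕ.+-assoc (h i) (h j) (rest h) ⟨
      (h i + h j) + rest h                 ∎
      where
      open ≡-Reasoning
      j≢i : j ≢ i
      j≢i = i≢j ∘ sym

    rest-≤ : rest f ≤ rest g
    rest-≤ = sum-mono-≤ pointwise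
      where
      pointwise : ∀ x → erase j (erase i f) x ≤ erase j (erase i g) x
      pointwise x with x ≟ j
      ... | yes _ = z≤n
      ... | no x≢j with x ≟ i
      ...   | yes _ = z≤n
      ...   | no x≢i = off x x≢i x≢j

  sum-≤-twoPoint : f i + f j ≤ g i + g j → sum f ≤ sum g
  sum-≤-twoPoint ≤ᵢⱼ =
    subst₂ _≤_ (sym (sum-split f)) (sym (sum-split g)) (ℕ.+-mono-≤ ≤ᵢⱼ rest-≤)

  sum-<-twoPoint : f i + f j < g i + g j → sum f < sum g
  sum-<-twoPoint <ᵢⱼ =
    subst₂ _<_ (sym (sum-split f)) (sym (sum-split g)) (ℕ.+-mono-<-≤ <ᵢⱼ rest-≤)

module _ {n} (a b : Fin n) where

  transpose-fst : transpose a b a ≡ b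
  transpose-fst with a ≟ a
  ... | yes _ = refl
  ... | no a≢a = ⊥-elim (a≢a refl)

  transpose-snd : transpose a b b ≡ a
  transpose-snd with b ≟ a
  ... | yes b≡a = b≡a
  ... | no _ with b ≟ b
  ...   | yes _ = refl
  ...   | no b≢b = ⊥-elim (b≢b refl)

  transpose-other : ∀ {x} → x ≢ a → x ≢ b → transpose a b x ≡ x
  transpose-other {x} x≢a x≢b with x ≟ a
  ... | yes x≡a = ⊥-elim (x≢a x≡a)
  ... | no _ with x ≟ b
  ...   | yes x≡b = ⊥-elim (x≢b x≡b)
  ...   | no _ = refl

transpose-cases : ∀ {n} (a b x : Fin n) → x ≡ a ⊎ x ≡ b ⊎ (x ≢ a × x ≢ b)
transpose-cases a b x with x ≟ a | x ≟ b
... | yes x≡a | _ = inj₁ x≡a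
... | no _ | yes x≡b = inj₂ (inj₁ x≡b)
... | no x≢a | no x≢b = inj₂ (inj₂ (x≢a , x≢b))

transpose-comm : ∀ {n} (a b : Fin n) → transpose a b ≗ transpose b a
transpose-comm a b x with transpose-cases a b x
... | inj₁ refl = trans (transpose-fst x b) (sym (transpose-snd b x))
... | inj₂ (inj₁ refl) = trans (transpose-snd a x) (sym (transpose-fst x a))
... | inj₂ (inj₂ (x≢a , x≢b)) =
  trans (transpose-other a b x≢a x≢b) (sym (transpose-other b a x≢b x≢a))

transpose-involutive : ∀ {n} (a b : Fin n) x → transpose a b (transpose a b x) ≡ x
transpose-involutive a b x = trans (cong (transpose a b) (transpose-comm a b x)) (transpose-inverse a b)

transpose-injective : ∀ {n} (a b : Fin n) {x y} → transpose a b x ≡ transpose a b y → x ≡ y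
transpose-injective a b {x} {y} eq =
  trans (sym (transpose-involutive a b x)) (trans (cong (transpose a b) eq) (transpose-involutive a b y))

transpose-conj : ∀ {n} {P : Fin n → Fin n} → (∀ x y → P x ≡ P y → x ≡ y) →
  ∀ a b → transpose (P a) (P b) ∘ P ≗ P ∘ transpose a b
transpose-conj {P = P} P-inj a b x with transpose-cases a b x
... | inj₁ refl = trans (transpose-fst (P x) (P b)) (cong P (sym (transpose-fst x b)))
... | inj₂ (inj₁ refl) = trans (transpose-snd (P a) (P x)) (cong P (sym (transpose-snd a x)))
... | inj₂ (inj₂ (x≢a , x≢b)) =
  trans (transpose-other (P a) (P b) (x≢a ∘ P-inj x a) (x≢b ∘ P-inj x b))
        (cong P (sym (transpose-other a b x≢a x≢b)))

transpose-invariant : ∀ {n} {A : Set} (c : Fin n → A) {a b} → c a ≡ c b → c ∘ transpose a b ≗ c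
transpose-invariant c {a} {b} ca≡cb x with transpose-cases a b x
... | inj₁ refl = trans (cong c (transpose-fst x b)) (sym ca≡cb)
... | inj₂ (inj₁ refl) = trans (cong c (transpose-snd a x)) ca≡cb
... | inj₂ (inj₂ (x≢a , x≢b)) = cong c (transpose-other a b x≢a x≢b)

descent : ∀ {n} (u v : Fin n) → ℕ
descent u v = if ⌊ v Fin.<? u ⌋ then 1 else 0

inversion : ∀ {n} (k m u v : Fin n) → ℕ
inversion k m u v = if ⌊ k Fin.<? m ⌋ ∧ ⌊ v Fin.<? u ⌋ then 1 else 0

inversions : ∀ {n} → (Fin n → Fin n) → ℕ
inversions {n} f = ∑[ k < n ] ∑[ m < n ] inversion k m (f k) (f m)

ℓ≡inversions : ∀ {n} (w : Perm n) → ℓ w ≡ inversions (lookup w)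
ℓ≡inversions {n} w =
  trans (sum-allFin {n} _) (sum-cong-≗ λ k → sum-allFin λ m → inversion k m (lookup w k) (lookup w m))

descent-< : ∀ {n} {u v : Fin n} → v Fin.< u → descent u v ≡ 1
descent-< {u = u} {v} v<u with v Fin.<? u
... | yes _ = refl
... | no v≮u = ⊥-elim (v≮u v<u)

descent-≮ : ∀ {n} {u v : Fin n} → ¬ v Fin.< u → descent u v ≡ 0
descent-≮ {u = u} {v} v≮u with v Fin.<? u
... | yes v<u = ⊥-elim (v≮u v<u)
... | no _ = refl

descent-mono : ∀ {n} {u u' v v' : Fin n} → u Fin.≤ u' → v' Fin.≤ v → descent u v ≤ descent u' v'
descent-mono {u = u} {u'} {v} {v'} u≤u' v'≤v with v Fin.<? u | v' Fin.<? u'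
... | yes _ | yes _ = ℕ.≤-refl
... | yes v<u | no v'≮u' = ⊥-elim (v'≮u' (ℕ.≤-<-trans v'≤v (ℕ.<-≤-trans v<u u≤u')))
... | no _ | _ = z≤n

inversion-< : ∀ {n} {k m : Fin n} u v → k Fin.< m → inversion k m u v ≡ descent u v
inversion-< {k = k} {m} u v k<m with k Fin.<? m
... | yes _ = refl
... | no k≮m = ⊥-elim (k≮m k<m)

inversion-≮ : ∀ {n} {k m : Fin n} u v → ¬ k Fin.< m → inversion k m u v ≡ 0
inversion-≮ {k = k} {m} u v k≮m with k Fin.<? m
... | yes k<m = ⊥-elim (k≮m k<m)
... | no _ = refl

inversion-mono : ∀ {n} (k m : Fin n) {u u' v v'} → u Fin.≤ u' → v' Fin.≤ v →
  inversion k m u v ≤ inversion k m u' v'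
inversion-mono k m u≤u' v'≤v with k Fin.<? m
... | yes _ = descent-mono u≤u' v'≤v
... | no _ = z≤n

inversion-row : ∀ {n} (k : Fin n) {i j} u {p q} → i Fin.< j → p Fin.< q →
  inversion k i u p + inversion k j u q ≤ inversion k i u q + inversion k j u p
inversion-row k {i} {j} u {p} {q} i<j p<q = cases (k Fin.<? i) (k Fin.<? j)
  where
  cases : Dec (k Fin.< i) → Dec (k Fin.< j) →
    inversion k i u p + inversion k j u q ≤ inversion k i u q + inversion k j u p
  cases (yes k<i) (yes k<j)
    rewrite inversion-< u p k<i | inversion-< u q k<j | inversion-< u q k<i | inversion-< u p k<j
    = ℕ.≤-reflexive (ℕ.+-comm (descent u p) (descent u q))
  cases (yes k<i) (no k≮j) = ⊥-elim (k≮j (ℕ.<-trans k<i i<j))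
  cases (no k≮i) (yes k<j) rewrite inversion-≮ u p k≮i | inversion-≮ u q k≮i
    = inversion-mono k j ℕ.≤-refl (ℕ.<⇒≤ p<q)
  cases (no k≮i) (no k≮j)
    rewrite inversion-≮ u p k≮i | inversion-≮ u q k≮j | inversion-≮ u q k≮i | inversion-≮ u p k≮j
    = z≤n

inversion-column : ∀ {n} (m : Fin n) {i j p q} v → i Fin.< j → p Fin.< q →
  inversion i m p v + inversion j m q v ≤ inversion i m q v + inversion j m p v
inversion-column m {i} {j} {p} {q} v i<j p<q = cases (j Fin.<? m)
  where
  cases : Dec (j Fin.< m) →
    inversion i m p v + inversion j m q v ≤ inversion i m q v + inversion j m p v
  cases (yes j<m)
    rewrite inversion-< p v (ℕ.<-trans i<j j<m) | inversion-< q v (ℕ.<-trans i<j j<m)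
          | inversion-< q v j<m | inversion-< p v j<m
    = ℕ.≤-reflexive (ℕ.+-comm (descent p v) (descent q v))
  cases (no j≮m) rewrite inversion-≮ q v j≮m | inversion-≮ p v j≮m
    = ℕ.+-monoˡ-≤ 0 (inversion-mono i m (ℕ.<⇒≤ p<q) ℕ.≤-refl)

-- Rows and columns other than i and j can only gain inversions (inversion-row, inversion-column),
-- while the pair (i, j) itself turns from an ascent into an inversion.
module _ {n} (f : Fin n → Fin n) {i j : Fin n} (i<j : i Fin.< j) (fi<fj : f i Fin.< f j) where

  private
    i≢j : i ≢ j
    i≢j = Fin.<⇒≢ i<j

    f' : Fin n → Fin n
    f' = f ∘ transpose i j

    f'i : f' i ≡ f j
    f'i = cong f (transpose-fst i j)

    f'j : f' j ≡ f i
    f'j = cong f (transpose-snd i j)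

    f'm : ∀ {m} → m ≢ i → m ≢ j → f' m ≡ f m
    f'm m≢i m≢j = cong f (transpose-other i j m≢i m≢j)

    row : (Fin n → Fin n) → Fin n → ℕ
    row g k = ∑[ m < n ] inversion k m (g k) (g m)

    column : (Fin n → Fin n) → Fin n → ℕ
    column g m = inversion i m (g i) (g m) + inversion j m (g j) (g m)

    other-rows : ∀ k → k ≢ i → k ≢ j → row f k ≤ row f' k
    other-rows k k≢i k≢j rewrite f'm k≢i k≢j = sum-≤-twoPoint i≢j same ends
      where
      same : ∀ m → m ≢ i → m ≢ j → inversion k m (f k) (f m) ≤ inversion k m (f k) (f' m)
      same m m≢i m≢j rewrite f'm m≢i m≢j = ℕ.≤-refl
      ends : inversion k i (f k) (f i) + inversion k j (f k) (f j)
           ≤ inversion k i (f k) (f' i) + inversion k j (f k) (f' j)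
      ends rewrite f'i | f'j = inversion-row k (f k) i<j fi<fj

    other-columns : ∀ m → m ≢ i → m ≢ j → column f m ≤ column f' m
    other-columns m m≢i m≢j rewrite f'i | f'j | f'm m≢i m≢j = inversion-column m (f m) i<j fi<fj

    diagonal : ∀ (k : Fin n) {u v} → inversion k k u v ≡ 0
    diagonal k {u} {v} = inversion-≮ {k = k} u v (ℕ.<-irrefl refl)

    descending-positions : inversion j i (f j) (f i) ≡ 0
    descending-positions = inversion-≮ (f j) (f i) (ℕ.<-asym i<j)

    ascent : inversion i j (f i) (f j) ≡ 0
    ascent = trans (inversion-< (f i) (f j) i<j) (descent-≮ (ℕ.<-asym fi<fj))

    swapped-ascent : inversion i j (f' i) (f' j) ≡ 1
    swapped-ascent =
      trans (cong₂ (inversion i j) f'i f'j) (trans (inversion-< (f j) (f i) i<j) (descent-< fi<fj))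

    ij-columns : column f i + column f j < column f' i + column f' j
    ij-columns = begin-strict
      column f i + column f j      ≡⟨ cong₂ _+_ (cong₂ _+_ (diagonal i) descending-positions)
                                                (cong₂ _+_ ascent (diagonal j)) ⟩
      0                            <⟨ s≤s z≤n ⟩
      1                            ≡⟨ swapped-ascent ⟨
      inversion i j (f' i) (f' j)  ≤⟨ ℕ.m≤m+n _ (inversion j j (f' j) (f' j)) ⟩
      column f' j                  ≤⟨ ℕ.m≤n+m _ (column f' i) ⟩
      column f' i + column f' j    ∎
      where open ℕ.≤-Reasoning

    ij-rows : row f i + row f j < row f' i + row f' j
    ij-rows = subst₂ _<_ (∑-distrib-+ (λ m → inversion i m (f i) (f m)) (λ m → inversion j m (f j) (f m)))
                         (∑-distrib-+ (λ m → inversion i m (f' i) (f' m)) (λ m → inversion j m (f' j) (f' m)))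
                         (sum-<-twoPoint i≢j other-columns ij-columns)

  inversions-<-∘transpose : inversions f < inversions (f ∘ transpose i j)
  inversions-<-∘transpose = sum-<-twoPoint i≢j other-rows ij-rows

inversions-cong : ∀ {n} {f g : Fin n → Fin n} → f ≗ g → inversions f ≡ inversions g
inversions-cong f≗g = sum-cong-≗ λ k → sum-cong-≗ λ m → cong₂ (inversion k m) (f≗g k) (f≗g m)

lookup-· : ∀ {n} (x y : Perm n) i → lookup (x · y) i ≡ lookup x (lookup y i)
lookup-· x y i = Vecₚ.lookup-map i (lookup x) y

lookup-transp : ∀ {n} (a b : Fin n) i → lookup (transp a b) i ≡ transpose a b i
lookup-transp a b = Vecₚ.lookup∘tabulate (transpose a b)

lookup-transp-· : ∀ {n} (a b : Fin n) x i → lookup (transp a b · x) i ≡ transpose a b (lookup x i)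
lookup-transp-· a b x i = trans (lookup-· (transp a b) x i) (lookup-transp a b (lookup x i))

lookup-e : ∀ {n} (i : Fin n) → lookup e i ≡ i
lookup-e = Vecₚ.lookup-allFin

lookup-extensionality : ∀ {n} {x y : Perm n} → (∀ i → lookup x i ≡ lookup y i) → x ≡ y
lookup-extensionality {x = x} {y} x≗y =
  trans (sym (Vecₚ.tabulate∘lookup x)) (trans (Vecₚ.tabulate-cong x≗y) (Vecₚ.tabulate∘lookup y))

·-identityˡ : ∀ {n} (x : Perm n) → e · x ≡ x
·-identityˡ x = lookup-extensionality λ i → trans (lookup-· e x i) (lookup-e (lookup x i))

·-identityʳ : ∀ {n} (x : Perm n) → x · e ≡ x
·-identityʳ = Vecₚ.map-lookup-allFin

·-assoc : ∀ {n} (x y z : Perm n) → (x · y) · z ≡ x · (y · z)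
·-assoc x y z = lookup-extensionality λ i → begin
  lookup ((x · y) · z) i            ≡⟨ lookup-· (x · y) z i ⟩
  lookup (x · y) (lookup z i)       ≡⟨ lookup-· x y (lookup z i) ⟩
  lookup x (lookup y (lookup z i))  ≡⟨ cong (lookup x) (lookup-· y z i) ⟨
  lookup x (lookup (y · z) i)       ≡⟨ lookup-· x (y · z) i ⟨
  lookup (x · (y · z)) i            ∎
  where open ≡-Reasoning

transp-comm : ∀ {n} (a b : Fin n) → transp a b ≡ transp b a
transp-comm a b = Vecₚ.tabulate-cong (transpose-comm a b)

transp-cancelˡ : ∀ {n} (a b : Fin n) {x y : Perm n} → transp a b · x ≡ transp a b · y → x ≡ y
transp-cancelˡ a b {x} {y} eq = lookup-extensionality λ i → transpose-injective a b
  (trans (sym (lookup-transp-· a b x i)) (trans (cong (λ w → lookup w i) eq) (lookup-transp-· a b y i)))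

transp-conjugate : ∀ {n} (a b x y : Fin n) →
  transp a b · (transp x y · transp a b) ≡ transp (transpose a b x) (transpose a b y)
transp-conjugate a b x y = lookup-extensionality λ z → begin
  lookup (transp a b · (transp x y · transp a b)) z  ≡⟨ lookup-transp-· a b (transp x y · transp a b) z ⟩
  τ (lookup (transp x y · transp a b) z)             ≡⟨ cong τ (lookup-transp-· x y (transp a b) z) ⟩
  τ (transpose x y (lookup (transp a b) z))          ≡⟨ cong (τ ∘ transpose x y) (lookup-transp a b z) ⟩
  τ (transpose x y (τ z))                            ≡⟨ transpose-conj τ-injective x y (τ z) ⟨
  transpose (τ x) (τ y) (τ (τ z))                    ≡⟨ cong (transpose (τ x) (τ y)) (τ-involutive z) ⟩
  transpose (τ x) (τ y) z                            ≡⟨ lookup-transp (τ x) (τ y) z ⟨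
  lookup (transp (τ x) (τ y)) z                      ∎
  where
  open ≡-Reasoning
  τ : Fin _ → Fin _
  τ = transpose a b
  τ-injective : ∀ u v → τ u ≡ τ v → u ≡ v
  τ-injective u v = transpose-injective a b
  τ-involutive : ∀ u → τ (τ u) ≡ u
  τ-involutive = transpose-involutive a b

transp-conj : ∀ {n} {P : Perm n} → IsPerm P →
  ∀ a b → transp (lookup P a) (lookup P b) · P ≡ P · transp a b
transp-conj {P = P} P-perm a b = lookup-extensionality λ z → begin
  lookup (transp (lookup P a) (lookup P b) · P) z   ≡⟨ lookup-transp-· (lookup P a) (lookup P b) P z ⟩
  transpose (lookup P a) (lookup P b) (lookup P z)   ≡⟨ transpose-conj P-perm a b z ⟩
  lookup P (transpose a b z)                         ≡⟨ cong (lookup P) (lookup-transp a b z) ⟨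
  lookup P (lookup (transp a b) z)                   ≡⟨ lookup-· P (transp a b) z ⟨
  lookup (P · transp a b) z                          ∎
  where open ≡-Reasoning

IsPerm-e : ∀ {n} → IsPerm (e {n})
IsPerm-e i j eq = trans (sym (lookup-e i)) (trans eq (lookup-e j))

IsPerm-· : ∀ {n} {x y : Perm n} → IsPerm x → IsPerm y → IsPerm (x · y)
IsPerm-· {x = x} {y} x-inj y-inj i j eq =
  y-inj i j (x-inj _ _ (trans (sym (lookup-· x y i)) (trans eq (lookup-· x y j))))

IsPerm-transp : ∀ {n} (a b : Fin n) → IsPerm (transp a b)
IsPerm-transp a b i j eq =
  transpose-injective a b (trans (sym (lookup-transp a b i)) (trans eq (lookup-transp a b j)))

-- Bruhat edges from ascents

ℓ-<-swap : ∀ {n} {w : Perm n} → IsPerm w → ∀ {i j} → i Fin.< j → lookup w i Fin.< lookup w j →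
  ℓ w < ℓ (transp (lookup w i) (lookup w j) · w)
ℓ-<-swap {w = w} w-perm {i} {j} i<j wi<wj = begin-strict
  ℓ w                                    ≡⟨ ℓ≡inversions w ⟩
  inversions (lookup w)                  <⟨ inversions-<-∘transpose (lookup w) i<j wi<wj ⟩
  inversions (lookup w ∘ transpose i j)  ≡⟨ inversions-cong swapped ⟨
  inversions (lookup w')                 ≡⟨ ℓ≡inversions w' ⟨
  ℓ w'                                   ∎
  where
  open ℕ.≤-Reasoning
  w' : Perm _
  w' = transp (lookup w i) (lookup w j) · w
  swapped : lookup w' ≗ lookup w ∘ transpose i j
  swapped m = trans (lookup-transp-· (lookup w i) (lookup w j) w m) (transpose-conj w-perm i j m)

⟶-swap : ∀ {n} {w : Perm n} → IsPerm w → ∀ {i j p q} → i Fin.< j → p Fin.< q →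
  lookup w i ≡ p → lookup w j ≡ q → w ⟶ (transp p q · w)
⟶-swap {w = w} w-perm {i} {j} i<j p<q refl refl =
  transp (lookup w i) (lookup w j) , (lookup w i , lookup w j , Fin.<⇒≢ p<q , refl) , refl ,
  ℓ-<-swap {w = w} w-perm i<j p<q

transp-≤B-extendʳ : ∀ {n} {a b d : Fin n} → a Fin.< b → b Fin.< d → transp a b ≤B transp a d
transp-≤B-extendʳ {a = a} {b} {d} a<b b<d = first ◅ subst (x ⟶_) conjugate second ◅ ε
  where
  a<d : a Fin.< d
  a<d = ℕ.<-trans a<b b<d
  d-fixed : transpose a b d ≡ d
  d-fixed = transpose-other a b (Fin.<⇒≢ a<d ∘ sym) (Fin.<⇒≢ b<d ∘ sym)
  x : Perm _
  x = transp b d · transp a b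
  x-at : ∀ m → lookup x m ≡ transpose b d (transpose a b m)
  x-at m = trans (lookup-transp-· b d (transp a b) m) (cong (transpose b d) (lookup-transp a b m))
  first : transp a b ⟶ x
  first = ⟶-swap {w = transp a b} (IsPerm-transp a b) a<d b<d
    (trans (lookup-transp a b a) (transpose-fst a b)) (trans (lookup-transp a b d) d-fixed)
  second : x ⟶ (transp a b · x)
  second = ⟶-swap {w = x} (IsPerm-· {x = transp b d} {y = transp a b} (IsPerm-transp b d) (IsPerm-transp a b))
    b<d a<b
    (trans (x-at b) (trans (cong (transpose b d) (transpose-snd a b))
                           (transpose-other b d (Fin.<⇒≢ a<b) (Fin.<⇒≢ a<d))))
    (trans (x-at d) (trans (cong (transpose b d) d-fixed) (transpose-snd b d)))
  conjugate : transp a b · x ≡ transp a d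
  conjugate = trans (transp-conjugate a b b d) (cong₂ transp (transpose-snd a b) d-fixed)

transp-≤B-extendˡ : ∀ {n} {a c b : Fin n} → a Fin.< c → c Fin.< b → transp c b ≤B transp a b
transp-≤B-extendˡ {a = a} {c} {b} a<c c<b = first ◅ subst (x ⟶_) conjugate second ◅ ε
  where
  a<b : a Fin.< b
  a<b = ℕ.<-trans a<c c<b
  a-fixed : transpose c b a ≡ a
  a-fixed = transpose-other c b (Fin.<⇒≢ a<c) (Fin.<⇒≢ a<b)
  x : Perm _
  x = transp a c · transp c b
  x-at : ∀ m → lookup x m ≡ transpose a c (transpose c b m)
  x-at m = trans (lookup-transp-· a c (transp c b) m) (cong (transpose a c) (lookup-transp c b m))
  first : transp c b ⟶ x
  first = ⟶-swap {w = transp c b} (IsPerm-transp c b) a<b a<c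
    (trans (lookup-transp c b a) a-fixed) (trans (lookup-transp c b b) (transpose-snd c b))
  second : x ⟶ (transp c b · x)
  second = ⟶-swap {w = x} (IsPerm-· {x = transp a c} {y = transp c b} (IsPerm-transp a c) (IsPerm-transp c b))
    a<c c<b
    (trans (x-at a) (trans (cong (transpose a c) a-fixed) (transpose-fst a c)))
    (trans (x-at c) (trans (cong (transpose a c) (transpose-fst c b))
                           (transpose-other a c (Fin.<⇒≢ a<b ∘ sym) (Fin.<⇒≢ c<b ∘ sym))))
  conjugate : transp c b · x ≡ transp a b
  conjugate = trans (transp-conjugate c b a c) (cong₂ transp a-fixed (transpose-fst c b))

-- Admissible products of transpositions

Pair : ℕ → Set
Pair n = Fin n × Fin n

Apart : ∀ {n} → Pair n → Pair n → Set
Apart (a , b) (c , d) = a ≢ c × b ≢ d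

Apart-sym : ∀ {n} {p q : Pair n} → Apart p q → Apart q p
Apart-sym (a≢c , b≢d) = a≢c ∘ sym , b≢d ∘ sym

incomparable⇒Apart : ∀ {n} {a b c d : Fin n} → a Fin.< b → c Fin.< d →
  ¬ transp a b ≤B transp c d → ¬ transp c d ≤B transp a b → Apart (a , b) (c , d)
incomparable⇒Apart {a = a} {b} {c} {d} a<b c<d ab≰cd cd≰ab = a≢c , b≢d
  where
  a≢c : a ≢ c
  a≢c refl with Fin.<-cmp b d
  ... | tri< b<d _ _ = ab≰cd (transp-≤B-extendʳ a<b b<d)
  ... | tri≈ _ refl _ = ab≰cd ε
  ... | tri> _ _ d<b = cd≰ab (transp-≤B-extendʳ c<d d<b)
  b≢d : b ≢ d
  b≢d refl with Fin.<-cmp a c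
  ... | tri< a<c _ _ = cd≰ab (transp-≤B-extendˡ a<c c<d)
  ... | tri≈ _ refl _ = ab≰cd ε
  ... | tri> _ _ c<a = ab≰cd (transp-≤B-extendˡ c<a a<b)

transpᵖ : ∀ {n} → Pair n → Perm n
transpᵖ (a , b) = transp a b

prodᵖ : ∀ {n} → List (Pair n) → Perm n
prodᵖ [] = e
prodᵖ (p ∷ L) = transpᵖ p · prodᵖ L

apply : ∀ {n} → List (Pair n) → Fin n → Fin n
apply L = lookup (prodᵖ L)

apply-cons : ∀ {n} (a b : Fin n) L x → apply ((a , b) ∷ L) x ≡ transpose a b (apply L x)
apply-cons a b L = lookup-transp-· a b (prodᵖ L)

apply-surjective : ∀ {n} (L : List (Pair n)) y → ∃ λ i → apply L i ≡ y
apply-surjective [] y = y , lookup-e y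
apply-surjective ((a , b) ∷ L) y with apply-surjective L (transpose a b y)
... | i , Lᵢ≡ = i , trans (apply-cons a b L i) (trans (cong (transpose a b) Lᵢ≡) (transpose-involutive a b y))

IsPerm-prodᵖ : ∀ {n} (L : List (Pair n)) → IsPerm (prodᵖ L)
IsPerm-prodᵖ [] = IsPerm-e
IsPerm-prodᵖ ((a , b) ∷ L) = IsPerm-· {x = transp a b} {y = prodᵖ L} (IsPerm-transp a b) (IsPerm-prodᵖ L)

prodᵖ-++ : ∀ {n} (L₁ L₂ : List (Pair n)) → prodᵖ (L₁ ++ L₂) ≡ prodᵖ L₁ · prodᵖ L₂
prodᵖ-++ [] L₂ = sym (·-identityˡ (prodᵖ L₂))
prodᵖ-++ (p ∷ L₁) L₂ =
  trans (cong (transpᵖ p ·_) (prodᵖ-++ L₁ L₂)) (sym (·-assoc (transpᵖ p) (prodᵖ L₁) (prodᵖ L₂)))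

data Admissible {n} : List (Pair n) → Set where
  [] : Admissible []
  cons : ∀ {a b L} → a Fin.< b → All (Apart (a , b)) L → Admissible L → Admissible ((a , b) ∷ L)

_∉ˡ_ : ∀ {n} → Fin n → List (Pair n) → Set
x ∉ˡ L = All (λ p → x ≢ proj₁ p) L

_∉ʳ_ : ∀ {n} → Fin n → List (Pair n) → Set
x ∉ʳ L = All (λ p → x ≢ proj₂ p) L

Apart⇒∉ˡ : ∀ {n} {a b : Fin n} {L} → All (Apart (a , b)) L → a ∉ˡ L
Apart⇒∉ˡ = All.map proj₁

Apart⇒∉ʳ : ∀ {n} {a b : Fin n} {L} → All (Apart (a , b)) L → b ∉ʳ L
Apart⇒∉ʳ = All.map proj₂

∉ˡ⇒apply≤ : ∀ {n} {L : List (Pair n)} → Admissible L → ∀ {x} → x ∉ˡ L →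
  apply L x Fin.≤ x × (∀ {y} → y ∉ˡ L → apply L x ≡ y → y ≡ x)
∉ˡ⇒apply≤ [] {x} _ =
  ℕ.≤-reflexive (cong toℕ (lookup-e x)) , λ _ x≡y → trans (sym x≡y) (lookup-e x)
∉ˡ⇒apply≤ (cons {a} {b} {L} a<b apart adm) {x} (x≢a ∷ x∉)
  with ∉ˡ⇒apply≤ adm x∉ | transpose-cases a b (apply L x)
... | _ , only-x | inj₁ Lx≡a = ⊥-elim (x≢a (sym (only-x (Apart⇒∉ˡ apart) Lx≡a)))
... | Lx≤x , _ | inj₂ (inj₁ Lx≡b) =
  subst (Fin._≤ x) (sym value) (ℕ.<⇒≤ (ℕ.<-≤-trans a<b (subst (Fin._≤ x) Lx≡b Lx≤x))) ,
  λ { (y≢a ∷ _) value≡y → ⊥-elim (y≢a (trans (sym value≡y) value)) }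
  where
  value : apply ((a , b) ∷ L) x ≡ a
  value = trans (apply-cons a b L x) (trans (cong (transpose a b) Lx≡b) (transpose-snd a b))
... | Lx≤x , only-x | inj₂ (inj₂ (Lx≢a , Lx≢b)) =
  subst (Fin._≤ x) (sym value) Lx≤x , λ { (_ ∷ y∉) value≡y → only-x y∉ (trans (sym value) value≡y) }
  where
  value : apply ((a , b) ∷ L) x ≡ apply L x
  value = trans (apply-cons a b L x) (transpose-other a b Lx≢a Lx≢b)

∉ʳ⇒≤apply : ∀ {n} {L : List (Pair n)} → Admissible L → ∀ {x} → x ∉ʳ L →
  x Fin.≤ apply L x × (∀ {y} → y ∉ʳ L → apply L x ≡ y → y ≡ x)
∉ʳ⇒≤apply [] {x} _ =
  ℕ.≤-reflexive (cong toℕ (sym (lookup-e x))) , λ _ x≡y → trans (sym x≡y) (lookup-e x)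
∉ʳ⇒≤apply (cons {a} {b} {L} a<b apart adm) {x} (x≢b ∷ x∉)
  with ∉ʳ⇒≤apply adm x∉ | transpose-cases a b (apply L x)
... | x≤Lx , _ | inj₁ Lx≡a =
  subst (x Fin.≤_) (sym value) (ℕ.<⇒≤ (ℕ.≤-<-trans (subst (x Fin.≤_) Lx≡a x≤Lx) a<b)) ,
  λ { (y≢b ∷ _) value≡y → ⊥-elim (y≢b (trans (sym value≡y) value)) }
  where
  value : apply ((a , b) ∷ L) x ≡ b
  value = trans (apply-cons a b L x) (trans (cong (transpose a b) Lx≡a) (transpose-fst a b))
... | _ , only-x | inj₂ (inj₁ Lx≡b) = ⊥-elim (x≢b (sym (only-x (Apart⇒∉ʳ apart) Lx≡b)))
... | x≤Lx , only-x | inj₂ (inj₂ (Lx≢a , Lx≢b)) =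
  subst (x Fin.≤_) (sym value) x≤Lx , λ { (_ ∷ y∉) value≡y → only-x y∉ (trans (sym value) value≡y) }
  where
  value : apply ((a , b) ∷ L) x ≡ apply L x
  value = trans (apply-cons a b L x) (transpose-other a b Lx≢a Lx≢b)

apply-cons⁻¹ : ∀ {n} (a b : Fin n) L {i x} → apply ((a , b) ∷ L) i ≡ x → apply L i ≡ transpose a b x
apply-cons⁻¹ a b L {i} eq =
  trans (sym (transpose-involutive a b (apply L i))) (cong (transpose a b) (trans (sym (apply-cons a b L i)) eq))

∉ˡ⇒preimage≤ : ∀ {n} {L : List (Pair n)} → Admissible L →
  ∀ {x} → x ∉ˡ L → ∀ {i} → apply L i ≡ x → i Fin.≤ x
∉ˡ⇒preimage≤ [] _ {i} Lᵢ≡x = ℕ.≤-reflexive (cong toℕ (trans (sym (lookup-e i)) Lᵢ≡x))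
∉ˡ⇒preimage≤ (cons {a} {b} {L} a<b apart adm) {x} (x≢a ∷ x∉) Lᵢ≡x with x ≟ b
... | yes refl = ℕ.<⇒≤ (ℕ.≤-<-trans (∉ˡ⇒preimage≤ adm (Apart⇒∉ˡ apart)
                   (trans (apply-cons⁻¹ a x L Lᵢ≡x) (transpose-snd a x))) a<b)
... | no x≢b =
  ∉ˡ⇒preimage≤ adm x∉ (trans (apply-cons⁻¹ a b L Lᵢ≡x) (transpose-other a b x≢a x≢b))

∉ʳ⇒≤preimage : ∀ {n} {L : List (Pair n)} → Admissible L →
  ∀ {x} → x ∉ʳ L → ∀ {i} → apply L i ≡ x → x Fin.≤ i
∉ʳ⇒≤preimage [] _ {i} Lᵢ≡x = ℕ.≤-reflexive (cong toℕ (trans (sym Lᵢ≡x) (lookup-e i)))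
∉ʳ⇒≤preimage (cons {a} {b} {L} a<b apart adm) {x} (x≢b ∷ x∉) Lᵢ≡x with x ≟ a
... | yes refl = ℕ.<⇒≤ (ℕ.<-≤-trans a<b (∉ʳ⇒≤preimage adm (Apart⇒∉ʳ apart)
                   (trans (apply-cons⁻¹ x b L Lᵢ≡x) (transpose-fst x b))))
... | no x≢a =
  ∉ʳ⇒≤preimage adm x∉ (trans (apply-cons⁻¹ a b L Lᵢ≡x) (transpose-other a b x≢a x≢b))

Admissible-split : ∀ {n} (L₁ : List (Pair n)) {a b L₂} → Admissible (L₁ ++ (a , b) ∷ L₂) →
  Admissible L₁ × All (λ p → Apart p (a , b)) L₁ × a Fin.< b × All (Apart (a , b)) L₂ × Admissible L₂
Admissible-split [] (cons a<b apart adm) = [] , [] , a<b , apart , adm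
Admissible-split (_ ∷ L₁) (cons p<q apart adm) with Admissible-split L₁ adm | All.++⁻ L₁ apart
... | adm₁ , apart₁ , a<b , apart₂ , adm₂ | apartL₁ , apart-ab ∷ _ =
  cons p<q apartL₁ adm₁ , apart-ab ∷ apart₁ , a<b , apart₂ , adm₂

⟶-insert : ∀ {n} (L₁ : List (Pair n)) {a b L₂} → Admissible (L₁ ++ (a , b) ∷ L₂) →
  prodᵖ (L₁ ++ L₂) ⟶ prodᵖ (L₁ ++ (a , b) ∷ L₂)
⟶-insert L₁ {a} {b} {L₂} adm with Admissible-split L₁ adm
... | adm₁ , apart₁ , a<b , apart₂ , adm₂ =
  subst₂ _⟶_ (sym (prodᵖ-++ L₁ L₂)) (trans conjugated (sym (prodᵖ-++ L₁ ((a , b) ∷ L₂)))) edge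
  where
  P Q : Perm _
  P = prodᵖ L₁
  Q = prodᵖ L₂
  P-perm : IsPerm P
  P-perm = IsPerm-prodᵖ L₁
  i j : Fin _
  i = proj₁ (apply-surjective L₂ a)
  j = proj₁ (apply-surjective L₂ b)
  Qᵢ≡a : lookup Q i ≡ a
  Qᵢ≡a = proj₂ (apply-surjective L₂ a)
  Qⱼ≡b : lookup Q j ≡ b
  Qⱼ≡b = proj₂ (apply-surjective L₂ b)
  i<j : i Fin.< j
  i<j = ℕ.≤-<-trans (∉ˡ⇒preimage≤ adm₂ (Apart⇒∉ˡ apart₂) Qᵢ≡a)
          (ℕ.<-≤-trans a<b (∉ʳ⇒≤preimage adm₂ (Apart⇒∉ʳ apart₂) Qⱼ≡b))
  Pa<Pb : lookup P a Fin.< lookup P b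
  Pa<Pb = ℕ.≤-<-trans (proj₁ (∉ˡ⇒apply≤ adm₁ (Apart⇒∉ˡ (All.map Apart-sym apart₁))))
            (ℕ.<-≤-trans a<b (proj₁ (∉ʳ⇒≤apply adm₁ (Apart⇒∉ʳ (All.map Apart-sym apart₁)))))
  edge : (P · Q) ⟶ (transp (lookup P a) (lookup P b) · (P · Q))
  edge = ⟶-swap {w = P · Q} (IsPerm-· {x = P} {y = Q} P-perm (IsPerm-prodᵖ L₂)) i<j Pa<Pb
           (trans (lookup-· P Q i) (cong (lookup P) Qᵢ≡a)) (trans (lookup-· P Q j) (cong (lookup P) Qⱼ≡b))
  conjugated : transp (lookup P a) (lookup P b) · (P · Q) ≡ P · (transp a b · Q)
  conjugated = begin
    transp (lookup P a) (lookup P b) · (P · Q)   ≡⟨ ·-assoc (transp (lookup P a) (lookup P b)) P Q ⟨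
    (transp (lookup P a) (lookup P b) · P) · Q   ≡⟨ cong (_· Q) (transp-conj {P = P} P-perm a b) ⟩
    (P · transp a b) · Q                         ≡⟨ ·-assoc P (transp a b) Q ⟩
    P · (transp a b · Q)                         ∎
    where open ≡-Reasoning

-- The pairs of an admissible list are the arcs of disjoint increasing paths;
-- peak L x is the top of the path through x.
peak : ∀ {n} → List (Pair n) → Fin n → Fin n
peak [] x = x
peak ((a , b) ∷ L) x = if does (peak L x ≟ a) then peak L b else peak L x

peak-∉ˡ : ∀ {n} {L : List (Pair n)} {x} → x ∉ˡ L → peak L x ≡ x
peak-∉ˡ [] = refl
peak-∉ˡ {L = (a , b) ∷ L} {x} (x≢a ∷ x∉) rewrite peak-∉ˡ x∉ with x ≟ a
... | yes x≡a = ⊥-elim (x≢a x≡a)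
... | no _ = refl

≤-peak : ∀ {n} {L : List (Pair n)} → Admissible L → ∀ x → x Fin.≤ peak L x
≤-peak [] x = ℕ.≤-refl
≤-peak (cons {a} {b} {L} a<b _ adm) x with peak L x ≟ a
... | yes Lx≡a =
  ℕ.<⇒≤ (ℕ.≤-<-trans (subst (x Fin.≤_) Lx≡a (≤-peak adm x)) (ℕ.<-≤-trans a<b (≤-peak adm b)))
... | no _ = ≤-peak adm x

peak-pairs : ∀ {n} {L : List (Pair n)} → Admissible L →
  All (λ p → peak L (proj₁ p) ≡ peak L (proj₂ p)) L
peak-pairs [] = []
peak-pairs (cons {a} {b} {L} _ apart adm) = joined ∷ All.map (cong glue) (peak-pairs adm)
  where
  glue : Fin _ → Fin _
  glue y = if does (y ≟ a) then peak L b else y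
  joined : glue (peak L a) ≡ glue (peak L b)
  joined rewrite peak-∉ˡ (Apart⇒∉ˡ apart) with a ≟ a | peak L b ≟ a
  ... | no a≢a | _ = ⊥-elim (a≢a refl)
  ... | yes _ | yes _ = refl
  ... | yes _ | no _ = refl

apply-invariant : ∀ {n} {A : Set} (c : Fin n → A) {M} →
  All (λ p → c (proj₁ p) ≡ c (proj₂ p)) M → c ∘ apply M ≗ c
apply-invariant c [] z = cong c (lookup-e z)
apply-invariant c {(a , b) ∷ M} (ca≡cb ∷ invariant) z = begin
  c (apply ((a , b) ∷ M) z)     ≡⟨ cong c (apply-cons a b M z) ⟩
  c (transpose a b (apply M z)) ≡⟨ transpose-invariant c ca≡cb (apply M z) ⟩
  c (apply M z)                 ≡⟨ apply-invariant c invariant z ⟩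
  c z                           ∎
  where open ≡-Reasoning

transp-·-separates : ∀ {n} {A : Set} (c : Fin n → A) {a b} → c a ≢ c b → ∀ {M M'} →
  c ∘ apply M ≗ c → c ∘ apply M' ≗ c → transp a b · prodᵖ M ≢ prodᵖ M'
transp-·-separates c {a} {b} ca≢cb {M} {M'} M-inv M'-inv eq = ca≢cb (begin
  c a              ≡⟨ cong c Mᵢ≡a ⟨
  c (apply M i)    ≡⟨ M-inv i ⟩
  c i              ≡⟨ M'-inv i ⟨
  c (apply M' i)   ≡⟨ cong c M'ᵢ≡b ⟩
  c b              ∎)
  where
  open ≡-Reasoning
  i : Fin _
  i = proj₁ (apply-surjective M a)
  Mᵢ≡a : apply M i ≡ a
  Mᵢ≡a = proj₂ (apply-surjective M a)
  M'ᵢ≡b : apply M' i ≡ b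
  M'ᵢ≡b = begin
    apply M' i                             ≡⟨ cong (λ w → lookup w i) eq ⟨
    lookup (transp a b · prodᵖ M) i        ≡⟨ lookup-transp-· a b (prodᵖ M) i ⟩
    transpose a b (apply M i)              ≡⟨ cong (transpose a b) Mᵢ≡a ⟩
    transpose a b a                        ≡⟨ transpose-fst a b ⟩
    b                                      ∎

-- The cube

select : ∀ {A : Set} {k} → Subset k → Vec A k → List A
select [] [] = []
select (true ∷ S) (x ∷ xs) = x ∷ select S xs
select (false ∷ S) (x ∷ xs) = select S xs

All-select : ∀ {A : Set} {P : A → Set} {k} (S : Subset k) (xs : Vec A k) →
  All P (toList xs) → All P (select S xs)
All-select [] [] [] = []
All-select (true ∷ S) (x ∷ xs) (px ∷ pxs) = px ∷ All-select S xs pxs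
All-select (false ∷ S) (x ∷ xs) (_ ∷ pxs) = All-select S xs pxs

Admissible-select : ∀ {n k} (S : Subset k) (ps : Vec (Pair n) k) →
  Admissible (toList ps) → Admissible (select S ps)
Admissible-select [] [] [] = []
Admissible-select (true ∷ S) (_ ∷ ps) (cons a<b apart adm) =
  cons a<b (All-select S ps apart) (Admissible-select S ps adm)
Admissible-select (false ∷ S) (_ ∷ ps) (cons _ _ adm) = Admissible-select S ps adm

select-⊥ : ∀ {A : Set} {k} (xs : Vec A k) → select Sub.⊥ xs ≡ []
select-⊥ [] = refl
select-⊥ (x ∷ xs) = select-⊥ xs

select-⊤ : ∀ {A : Set} {k} (xs : Vec A k) → select Sub.⊤ xs ≡ toList xs
select-⊤ [] = refl
select-⊤ (x ∷ xs) = cong (x ∷_) (select-⊤ xs)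

select-⁅⁆ : ∀ {A : Set} {k} (xs : Vec A k) i → select ⁅ i ⁆ xs ≡ lookup xs i ∷ []
select-⁅⁆ (x ∷ xs) zero = cong (x ∷_) (select-⊥ xs)
select-⁅⁆ (x ∷ xs) (suc i) = select-⁅⁆ xs i

select-insert : ∀ {A : Set} {k} (S : Subset k) (xs : Vec A k) {i} → i ∉ S →
  ∃₂ λ L₁ L₂ → select (S ∪ ⁅ i ⁆) xs ≡ L₁ ++ lookup xs i ∷ L₂ × select S xs ≡ L₁ ++ L₂
select-insert (true ∷ S) (x ∷ xs) {zero} i∉S = ⊥-elim (i∉S here)
select-insert (false ∷ S) (x ∷ xs) {zero} _ =
  [] , select S xs , cong (λ T → x ∷ select T xs) (∪-identityʳ S) , refl
select-insert (true ∷ S) (x ∷ xs) {suc i} i∉S with select-insert S xs (i∉S ∘ there)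
... | L₁ , L₂ , eq₁ , eq₂ = x ∷ L₁ , L₂ , cong (x ∷_) eq₁ , cong (x ∷_) eq₂
select-insert (false ∷ S) (x ∷ xs) {suc i} i∉S = select-insert S xs (i∉S ∘ there)

cube : ∀ {n k} → Vec (Pair n) k → Subset k → Perm n
cube ps S = prodᵖ (select S ps)

cube-edge : ∀ {n k} (ps : Vec (Pair n) k) → Admissible (toList ps) →
  ∀ S i → i ∉ S → cube ps S ⟶ cube ps (S ∪ ⁅ i ⁆)
cube-edge ps adm S i i∉S with select-insert S ps i∉S
... | L₁ , L₂ , eq₁ , eq₂ = subst₂ _⟶_ (cong prodᵖ (sym eq₂)) (cong prodᵖ (sym eq₁))
  (⟶-insert L₁ (subst Admissible eq₁ (Admissible-select (S ∪ ⁅ i ⁆) ps adm)))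

cube-separated : ∀ {n k} {a b : Fin n} (ps : Vec (Pair n) k) → Admissible (toList ((a , b) ∷ ps)) →
  ∀ S S' → transp a b · cube ps S ≢ cube ps S'
cube-separated {a = a} {b} ps (cons a<b apart adm) S S' =
  transp-·-separates (peak (toList ps)) peak-a≢peak-b {select S ps} {select S' ps}
    (invariant S) (invariant S')
  where
  invariant : ∀ T → peak (toList ps) ∘ apply (select T ps) ≗ peak (toList ps)
  invariant T = apply-invariant (peak (toList ps)) (All-select T ps (peak-pairs adm))
  peak-a≢peak-b : peak (toList ps) a ≢ peak (toList ps) b
  peak-a≢peak-b peak-a≡peak-b = ℕ.<-irrefl refl (ℕ.<-≤-trans a<b
    (subst (b Fin.≤_) (trans (sym peak-a≡peak-b) (peak-∉ˡ (Apart⇒∉ˡ apart))) (≤-peak adm b)))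

cube-injective : ∀ {n k} (ps : Vec (Pair n) k) → Admissible (toList ps) →
  ∀ {S S'} → cube ps S ≡ cube ps S' → S ≡ S'
cube-injective [] [] {[]} {[]} _ = refl
cube-injective ((a , b) ∷ ps) (cons _ _ adm) {true ∷ S} {true ∷ S'} eq =
  cong (true ∷_) (cube-injective ps adm (transp-cancelˡ a b eq))
cube-injective (_ ∷ ps) (cons _ _ adm) {false ∷ S} {false ∷ S'} eq =
  cong (false ∷_) (cube-injective ps adm eq)
cube-injective (_ ∷ ps) adm {true ∷ S} {false ∷ S'} eq = ⊥-elim (cube-separated ps adm S S' eq)
cube-injective (_ ∷ ps) adm {false ∷ S} {true ∷ S'} eq = ⊥-elim (cube-separated ps adm S' S (sym eq))

e⟶⇒transp : ∀ {n} {y : Perm n} → e ⟶ y →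
  Σ (Pair n) λ p → proj₁ p Fin.< proj₂ p × y ≡ transpᵖ p
e⟶⇒transp (t , (a , b , a≢b , t≡ab) , y≡t·e , _) with Fin.<-cmp a b
... | tri< a<b _ _ = (a , b) , a<b , trans y≡t·e (trans (·-identityʳ t) t≡ab)
... | tri≈ _ a≡b _ = ⊥-elim (a≢b a≡b)
... | tri> _ _ b<a = (b , a) , b<a , trans y≡t·e (trans (·-identityʳ t) (trans t≡ab (transp-comm a b)))

Admissible-tabulate : ∀ {n k} (ps : Fin k → Pair n) → (∀ i → proj₁ (ps i) Fin.< proj₂ (ps i)) →
  (∀ i j → i ≢ j → Apart (ps i) (ps j)) → Admissible (toList (tabulate ps))
Admissible-tabulate {k = zero} ps _ _ = []
Admissible-tabulate {k = suc k} ps ascending apart =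
  cons (ascending zero) (All-tabulate λ i → apart zero (suc i) λ ())
       (Admissible-tabulate (ps ∘ suc) (ascending ∘ suc)
          λ i j i≢j → apart (suc i) (suc j) (i≢j ∘ Fin.suc-injective))
  where
  All-tabulate : ∀ {k} {P : Pair _ → Set} {f : Fin k → Pair _} →
    (∀ i → P (f i)) → All P (toList (tabulate f))
  All-tabulate {zero} _ = []
  All-tabulate {suc k} Pf = Pf zero ∷ All-tabulate (Pf ∘ suc)

antichain⇒Admissible : ∀ {n k} (Y : Vec (Perm n) k) → (∀ i → e ⟶ lookup Y i) →
  (∀ i j → i ≢ j → ¬ lookup Y i ≤B lookup Y j) →
  Σ (Vec (Pair n) k) λ ps → Admissible (toList ps) × (∀ i → lookup Y i ≡ transpᵖ (lookup ps i))
antichain⇒Admissible Y e⟶Y antichain = tabulate pair , Admissible-tabulate pair ascending apart , Yᵢ≡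
  where
  pair : Fin _ → Pair _
  pair i = proj₁ (e⟶⇒transp (e⟶Y i))
  ascending : ∀ i → proj₁ (pair i) Fin.< proj₂ (pair i)
  ascending i = proj₁ (proj₂ (e⟶⇒transp (e⟶Y i)))
  Yᵢ≡pair : ∀ i → lookup Y i ≡ transpᵖ (pair i)
  Yᵢ≡pair i = proj₂ (proj₂ (e⟶⇒transp (e⟶Y i)))
  Yᵢ≡ : ∀ i → lookup Y i ≡ transpᵖ (lookup (tabulate pair) i)
  Yᵢ≡ i = trans (Yᵢ≡pair i) (cong transpᵖ (sym (Vecₚ.lookup∘tabulate pair i)))
  incomparable : ∀ i j → i ≢ j → ¬ transpᵖ (pair i) ≤B transpᵖ (pair j)
  incomparable i j i≢j = antichain i j i≢j ∘ subst₂ _≤B_ (sym (Yᵢ≡pair i)) (sym (Yᵢ≡pair j))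
  apart : ∀ i j → i ≢ j → Apart (pair i) (pair j)
  apart i j i≢j =
    incomparable⇒Apart (ascending i) (ascending j) (incomparable i j i≢j) (incomparable j i (i≢j ∘ sym))

prod≡prodᵖ : ∀ {n k} (Y : Vec (Perm n) k) (ps : Vec (Pair n) k) →
  (∀ i → lookup Y i ≡ transpᵖ (lookup ps i)) → prod Y ≡ prodᵖ (toList ps)
prod≡prodᵖ [] [] _ = refl
prod≡prodᵖ (y ∷ Y) (p ∷ ps) Yᵢ≡ = cong₂ _·_ (Yᵢ≡ zero) (prod≡prodᵖ Y ps (Yᵢ≡ ∘ suc))

lemma4p16 : (n : ℕ) (v : Perm n) → IsPerm v →
    (I : Perm n → Set) → HypercubeDecomposition v I →
    (k : ℕ) (Y : Vec (Perm n) k) → InA v I e Y →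
    Σ (Subset k → Perm n) λ h →
      IsHypercube (λ _ → ⊤) k h × BottomSpanned h e Y × h Sub.⊤ ≡ prod Y
lemma4p16 n v _ I _ k Y (Y⊆𝒴ₑ , antichain) with antichain⇒Admissible Y (proj₂ ∘ proj₂ ∘ Y⊆𝒴ₑ) antichain
... | ps , admissible , Yᵢ≡ =
  cube ps , ((λ _ → tt) , cube-injective ps admissible , cube-edge ps admissible) , (bottom , atom) , top
  where
  bottom : cube ps Sub.⊥ ≡ e
  bottom = cong prodᵖ (select-⊥ ps)
  atom : ∀ i → cube ps ⁅ i ⁆ ≡ lookup Y i
  atom i = trans (cong prodᵖ (select-⁅⁆ ps i)) (trans (·-identityʳ _) (sym (Yᵢ≡ i)))
  top : cube ps Sub.⊤ ≡ prod Y
  top = trans (cong prodᵖ (select-⊤ ps)) (sym (prod≡prodᵖ Y ps Yᵢ≡))
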